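{- For every non-negative integer $L$, \[ \sum_{j=-L}^{L}\left(\frac{j+1}{3}\right)q^{j(j+1)}{2L\brack L-j}_q=\sum_{j=-L-1}^{L+1}\left(\frac{j+1}{3}\right)q^{j(j+1)}{2L+1\brack L-j}_q. \]
   Context: $(a;q)_n=\prod_{k=0}^{n-1}(1-aq^k)$. The $q$-binomial coefficient is ${m+n\brack m}_q=\frac{(q;q)_{m+n}}{(q;q)_m(q;q)_n}$ for $m,n\ge 0$ and $0$ otherwise. $\left(\frac{a}{3}\right)$ denotes the Jacobi symbol modulo 3: $0$ if $3\mid a$, $1$ if $a\equiv1\pmod 3$, $-1$ if $a\equiv 2\pmod 3$. -}

module Defs where

open import Data.Nat as ℕ using (ℕ; zero; suc; _∸_)
open import Data.Integer as ℤ using (ℤ; +_; -_; _+_; _*_; 0ℤ; 1ℤ)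
open import Data.Fin using (Fin; toℕ)
open import Data.Vec using (Vec; []; _∷_; lookup; reverse; tabulate)
open import Data.List using (List; []; _∷_)
open import Relation.Binary.PropositionalEquality using (_≡_)
open import Relation.Nullary using (yes; no)

-- Formal power series in q with integer coefficients: coefficient functions.
Series : Set
Series = ℕ → ℤ

_≋_ : Series → Series → Set
f ≋ g = ∀ n → f n ≡ g n

infix 4 _≋_
infixl 6 _⊕_
infixl 7 _⊛_

sumTo : ℕ → (ℕ → ℤ) → ℤ
sumTo zero    f = 0ℤ
sumTo (suc n) f = sumTo n f + f n

𝟘 : Series
𝟘 _ = 0ℤ

𝟙 : Series
𝟙 zero    = 1ℤ
𝟙 (suc _) = 0ℤ

_⊕_ : Series → Series → Series
(f ⊕ g) n = f n + g n

_⊛_ : Series → Series → Series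
(f ⊛ g) n = sumTo (suc n) (λ k → f k * g (n ∸ k))

_·_ : ℤ → Series → Series
(c · f) n = c * f n

qpow : ℕ → Series
qpow k n with k ℕ.≟ n
... | yes _ = 1ℤ
... | no  _ = 0ℤ

qPoch : ℕ → Series
qPoch zero    = 𝟙
qPoch (suc n) = qPoch n ⊛ (𝟙 ⊕ (- 1ℤ) · qpow (suc n))

-- Multiplicative inverse of a series with constant term 1 (the constant
-- term of the argument is ignored/assumed to be 1):
--   h 0 = 1,  h n = - Σ_{k=1}^{n} f k * h (n - k).
-- invVec f n = (h n , h (n-1) , … , h 0)
invVec : Series → (n : ℕ) → Vec ℤ (suc n)
invVec f zero    = 1ℤ ∷ []
invVec f (suc n) = hn ∷ prev
  where
  prev : Vec ℤ (suc n)
  prev = invVec f n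
  -- lookup prev i = h (n - i)  ;  term k (k = 1..n+1) uses h (n+1-k) = lookup prev (k-1)
  hn : ℤ
  hn = - sumTo (suc n) (λ i → f (suc i) * lookupℕ prev i)
    where
    lookupℕ : ∀ {m} → Vec ℤ m → ℕ → ℤ
    lookupℕ []       _       = 0ℤ
    lookupℕ (x ∷ xs) zero    = x
    lookupℕ (x ∷ xs) (suc i) = lookupℕ xs i

inv : Series → Series
inv f n with invVec f n
... | x ∷ _ = x

-- q-binomial coefficient [m+n choose m]_q = (q;q)_{m+n} / ((q;q)_m (q;q)_n)
-- qbinom N K = [N choose K]_q  for integers N, K; 0 unless 0 ≤ K ≤ N.
qbinomℕ : ℕ → ℕ → Series
qbinomℕ m n = qPoch (m ℕ.+ n) ⊛ inv (qPoch m ⊛ qPoch n)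

qbinom : ℤ → ℤ → Series
qbinom (+ N) (+ K) with K ℕ.≤? N
... | yes _ = qbinomℕ K (N ∸ K)
... | no _ = 𝟘
qbinom _ _ = 𝟘

jacobi3 : ℤ → ℤ
jacobi3 a with ℤ._%_ a (+ 3)
... | 1 = 1ℤ
... | 2 = - 1ℤ
... | _ = 0ℤ

symSum : ℕ → (ℤ → Series) → Series
symSum zero    f = f 0ℤ
symSum (suc M) f = symSum M f ⊕ f (+ suc M) ⊕ f (- (+ suc M))

-- q^{e} for an integer exponent e known to be ≥ 0 (j(j+1) ≥ 0); uses ∣e∣
qpowℤ : ℤ → Series
qpowℤ e = qpow ℤ.∣ e ∣

-- Pascal's rule [2L+1, L-j] = [2L, L-j] + q^(L+1+j) [2L, L-j-1] splits the right-hand side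
-- into the left-hand side, widened by two vanishing terms, and the sum over |j| ≤ L+1 of
--   (j+1 / 3) q^((j+1)² + L) [2L, L-j-1].
-- Under j ↦ -j-2 the character changes sign, while the exponent and, by the symmetry
-- [2L, k] = [2L, 2L-k], the q-binomial coefficient are unchanged; so the terms of this sum
-- cancel in pairs except those at j = L and j = L+1, and these vanish. The q-binomial
-- coefficients, defined as quotients of q-Pochhammer symbols, are identified with the
-- Gaussian polynomials of Pascal's recursion through (q;q)_(k+b) = [k+b, k] (q;q)_k (q;q)_b.
module Submission where

open import Defs
open import Data.Nat as ℕ using (ℕ; zero; suc; _∸_; s≤s)
import Data.Nat.Properties as ℕP
open import Data.Nat.DivMod using (m%n<n)
open import Data.Integer as ℤ using (ℤ; +_; -[1+_]; -_; _+_; _-_; _*_; 0ℤ; 1ℤ)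
import Data.Integer.Properties as ℤP
open import Data.Integer.Tactic.RingSolver using (solve-∀)
open import Data.Product using (Σ; ∃; ∃₂; _,_; proj₁; proj₂; _×_)
open import Data.Sum using (_⊎_; inj₁; inj₂)
open import Data.Empty using (⊥-elim)
open import Algebra.Bundles using (CommutativeMonoid)
open import Algebra.Properties.AbelianGroup ℤP.+-0-abelianGroup using () renaming (∙-cancelˡ to +-cancelˡ; ∙-cancelʳ to +-cancelʳ)
import Algebra.Solver.CommutativeMonoid as CommutativeMonoidSolver
open import Relation.Binary.Bundles using (Setoid)
import Relation.Binary.Reasoning.Setoid
open import Relation.Binary.Definitions using (tri<; tri≈; tri>)
open import Relation.Binary.PropositionalEquality
open import Relation.Nullary using (yes; no)

-- Finite sums

sumTo-cong : ∀ n {f g : ℕ → ℤ} → (∀ i → i ℕ.< n → f i ≡ g i) → sumTo n f ≡ sumTo n g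
sumTo-cong zero    f≗g = refl
sumTo-cong (suc n) f≗g = cong₂ _+_ (sumTo-cong n (λ i i<n → f≗g i (ℕP.m≤n⇒m≤1+n i<n))) (f≗g n ℕP.≤-refl)

sumTo-zero : ∀ n {f : ℕ → ℤ} → (∀ i → i ℕ.< n → f i ≡ 0ℤ) → sumTo n f ≡ 0ℤ
sumTo-zero zero    f≗0 = refl
sumTo-zero (suc n) f≗0 = cong₂ _+_ (sumTo-zero n (λ i i<n → f≗0 i (ℕP.m≤n⇒m≤1+n i<n))) (f≗0 n ℕP.≤-refl)

sumTo-distrib-+ : ∀ n (f g : ℕ → ℤ) → sumTo n (λ i → f i + g i) ≡ sumTo n f + sumTo n g
sumTo-distrib-+ zero    f g = refl
sumTo-distrib-+ (suc n) f g = begin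
  sumTo n (λ i → f i + g i) + (f n + g n) ≡⟨ cong (_+ (f n + g n)) (sumTo-distrib-+ n f g) ⟩
  sumTo n f + sumTo n g + (f n + g n)     ≡⟨ interchange (sumTo n f) (sumTo n g) (f n) (g n) ⟩
  sumTo n f + f n + (sumTo n g + g n)     ∎
  where
  open ≡-Reasoning
  interchange : ∀ a b c d → a + b + (c + d) ≡ a + c + (b + d)
  interchange = solve-∀

*-distribˡ-sumTo : ∀ n c (f : ℕ → ℤ) → c * sumTo n f ≡ sumTo n (λ i → c * f i)
*-distribˡ-sumTo zero    c f = ℤP.*-zeroʳ c
*-distribˡ-sumTo (suc n) c f =
  trans (ℤP.*-distribˡ-+ c (sumTo n f) (f n)) (cong (_+ c * f n) (*-distribˡ-sumTo n c f))

*-distribʳ-sumTo : ∀ n c (f : ℕ → ℤ) → sumTo n f * c ≡ sumTo n (λ i → f i * c)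
*-distribʳ-sumTo n c f = trans (ℤP.*-comm (sumTo n f) c)
  (trans (*-distribˡ-sumTo n c f) (sumTo-cong n (λ i _ → ℤP.*-comm c (f i))))

sumTo-unfoldˡ : ∀ n (f : ℕ → ℤ) → sumTo (suc n) f ≡ f 0 + sumTo n (λ i → f (suc i))
sumTo-unfoldˡ zero    f = ℤP.+-comm 0ℤ (f 0)
sumTo-unfoldˡ (suc n) f = trans (cong (_+ f (suc n)) (sumTo-unfoldˡ n f)) (ℤP.+-assoc (f 0) _ _)

sumTo-reverse : ∀ n (f : ℕ → ℤ) → sumTo n f ≡ sumTo n (λ i → f (n ∸ suc i))
sumTo-reverse zero    f = refl
sumTo-reverse (suc n) f = begin
  sumTo n f + f n                     ≡⟨ cong (_+ f n) (sumTo-reverse n f) ⟩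
  sumTo n (λ i → f (n ∸ suc i)) + f n ≡⟨ ℤP.+-comm _ (f n) ⟩
  f n + sumTo n (λ i → f (n ∸ suc i)) ≡⟨ sumTo-unfoldˡ n (λ i → f (n ∸ i)) ⟨
  sumTo (suc n) (λ i → f (n ∸ i))     ∎
  where open ≡-Reasoning

sumTo-single : ∀ n a (f : ℕ → ℤ) → a ℕ.< n → (∀ i → i ℕ.< n → i ≢ a → f i ≡ 0ℤ) → sumTo n f ≡ f a
sumTo-single (suc n) a f a<1+n f≗0 with a ℕ.≟ n
... | yes refl = trans (cong (_+ f a) (sumTo-zero n (λ i i<n → f≗0 i (ℕP.m≤n⇒m≤1+n i<n) (ℕP.<⇒≢ i<n))))
                       (ℤP.+-identityˡ (f a))
... | no a≢n   = trans (cong₂ _+_ (sumTo-single n a f (ℕP.≤∧≢⇒< (ℕP.≤-pred a<1+n) a≢n)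
                                                  (λ i i<n → f≗0 i (ℕP.m≤n⇒m≤1+n i<n)))
                                  (f≗0 n ℕP.≤-refl (≢-sym a≢n)))
                       (ℤP.+-identityʳ (f a))

sumTo-triangle : ∀ n (f : ℕ → ℕ → ℤ) →
  sumTo n (λ k → sumTo (suc k) (λ i → f i k)) ≡ sumTo n (λ i → sumTo (n ∸ i) (λ l → f i (i ℕ.+ l)))
sumTo-triangle zero    f = refl
sumTo-triangle (suc n) f = begin
  sumTo n (λ k → sumTo (suc k) (λ i → f i k)) + (sumTo n (λ i → f i n) + f n n)
    ≡⟨ cong (_+ (sumTo n (λ i → f i n) + f n n)) (sumTo-triangle n f) ⟩
  sumTo n (λ i → row i (n ∸ i)) + (sumTo n (λ i → f i n) + f n n)
    ≡⟨ ℤP.+-assoc (sumTo n (λ i → row i (n ∸ i))) (sumTo n (λ i → f i n)) (f n n) ⟨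
  sumTo n (λ i → row i (n ∸ i)) + sumTo n (λ i → f i n) + f n n
    ≡⟨ cong₂ _+_ (trans (sym (sumTo-distrib-+ n _ _)) (sumTo-cong n extendRow)) lastRow ⟩
  sumTo n (λ i → row i (suc n ∸ i)) + row n (suc n ∸ n) ∎
  where
  open ≡-Reasoning
  row : ℕ → ℕ → ℤ
  row i m = sumTo m (λ l → f i (i ℕ.+ l))
  extendRow : ∀ i → i ℕ.< n → row i (n ∸ i) + f i n ≡ row i (suc n ∸ i)
  extendRow i i<n rewrite ℕP.+-∸-assoc 1 (ℕP.<⇒≤ i<n) =
    cong (λ k → row i (n ∸ i) + f i k) (sym (ℕP.m+[n∸m]≡n (ℕP.<⇒≤ i<n)))
  lastRow : f n n ≡ row n (suc n ∸ n)
  lastRow rewrite ℕP.+-∸-assoc 1 (ℕP.≤-refl {n}) | ℕP.n∸n≡0 n | ℕP.+-identityʳ n = sym (ℤP.+-identityˡ (f n n))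

-- Formal power series

≋-refl : ∀ {f} → f ≋ f
≋-refl n = refl

≡⇒≋ : ∀ {f g} → f ≡ g → f ≋ g
≡⇒≋ refl = ≋-refl

≋-sym : ∀ {f g} → f ≋ g → g ≋ f
≋-sym f≋g n = sym (f≋g n)

≋-trans : ∀ {f g h} → f ≋ g → g ≋ h → f ≋ h
≋-trans f≋g g≋h n = trans (f≋g n) (g≋h n)

≋-setoid : Setoid _ _
≋-setoid = record
  { Carrier = Series ; _≈_ = _≋_
  ; isEquivalence = record { refl = ≋-refl ; sym = ≋-sym ; trans = ≋-trans } }

module ≋-Reasoning = Relation.Binary.Reasoning.Setoid ≋-setoid

⊕-cong : ∀ {f f′ g g′} → f ≋ f′ → g ≋ g′ → f ⊕ g ≋ f′ ⊕ g′
⊕-cong f≋f′ g≋g′ n = cong₂ _+_ (f≋f′ n) (g≋g′ n)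

⊕-identityʳ : ∀ f → f ⊕ 𝟘 ≋ f
⊕-identityʳ f n = ℤP.+-identityʳ (f n)

·-cong : ∀ c {f g} → f ≋ g → c · f ≋ c · g
·-cong c f≋g n = cong (c *_) (f≋g n)

·-distrib-⊕ : ∀ c f g → c · (f ⊕ g) ≋ c · f ⊕ c · g
·-distrib-⊕ c f g n = ℤP.*-distribˡ-+ c (f n) (g n)

·-zero : ∀ c {f} → f ≋ 𝟘 → c · f ≋ 𝟘
·-zero c f≋0 n = trans (cong (c *_) (f≋0 n)) (ℤP.*-zeroʳ c)

⊛-cong : ∀ {f f′ g g′} → f ≋ f′ → g ≋ g′ → f ⊛ g ≋ f′ ⊛ g′
⊛-cong f≋f′ g≋g′ n = sumTo-cong (suc n) (λ k _ → cong₂ _*_ (f≋f′ k) (g≋g′ (n ∸ k)))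

⊛-comm : ∀ f g → f ⊛ g ≋ g ⊛ f
⊛-comm f g n = trans (sumTo-reverse (suc n) _) (sumTo-cong (suc n) λ i i≤n →
  trans (cong (λ k → f (n ∸ i) * g k) (ℕP.m∸[m∸n]≡n (ℕP.≤-pred i≤n))) (ℤP.*-comm (f (n ∸ i)) (g i)))

⊛-assoc : ∀ f g h → (f ⊛ g) ⊛ h ≋ f ⊛ (g ⊛ h)
⊛-assoc f g h n = begin
  sumTo (suc n) (λ k → sumTo (suc k) (λ i → f i * g (k ∸ i)) * h (n ∸ k))
    ≡⟨ sumTo-cong (suc n) (λ k _ → *-distribʳ-sumTo (suc k) (h (n ∸ k)) _) ⟩
  sumTo (suc n) (λ k → sumTo (suc k) (λ i → f i * g (k ∸ i) * h (n ∸ k)))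
    ≡⟨ sumTo-triangle (suc n) (λ i k → f i * g (k ∸ i) * h (n ∸ k)) ⟩
  sumTo (suc n) (λ i → sumTo (suc n ∸ i) (λ l → f i * g (i ℕ.+ l ∸ i) * h (n ∸ (i ℕ.+ l))))
    ≡⟨ sumTo-cong (suc n) inner ⟩
  sumTo (suc n) (λ i → f i * sumTo (suc (n ∸ i)) (λ l → g l * h (n ∸ i ∸ l))) ∎
  where
  open ≡-Reasoning
  inner : ∀ i → i ℕ.< suc n →
    sumTo (suc n ∸ i) (λ l → f i * g (i ℕ.+ l ∸ i) * h (n ∸ (i ℕ.+ l)))
      ≡ f i * sumTo (suc (n ∸ i)) (λ l → g l * h (n ∸ i ∸ l))
  inner i i≤n rewrite ℕP.+-∸-assoc 1 (ℕP.≤-pred i≤n) = trans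
    (sumTo-cong (suc (n ∸ i)) (λ l _ →
      trans (cong₂ (λ a b → f i * g a * h b) (ℕP.m+n∸m≡n i l) (sym (ℕP.∸-+-assoc n i l)))
            (ℤP.*-assoc (f i) (g l) (h (n ∸ i ∸ l)))))
    (sym (*-distribˡ-sumTo (suc (n ∸ i)) (f i) _))

⊛-distribʳ-⊕ : ∀ f g h → (f ⊕ g) ⊛ h ≋ f ⊛ h ⊕ g ⊛ h
⊛-distribʳ-⊕ f g h n = trans (sumTo-cong (suc n) (λ k _ → ℤP.*-distribʳ-+ (h (n ∸ k)) (f k) (g k)))
                             (sumTo-distrib-+ (suc n) _ _)

⊛-distribˡ-⊕ : ∀ h f g → h ⊛ (f ⊕ g) ≋ h ⊛ f ⊕ h ⊛ g
⊛-distribˡ-⊕ h f g = ≋-trans (⊛-comm h (f ⊕ g))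
  (≋-trans (⊛-distribʳ-⊕ f g h) (⊕-cong (⊛-comm f h) (⊛-comm g h)))

·-⊛ : ∀ c f g → (c · f) ⊛ g ≋ c · (f ⊛ g)
·-⊛ c f g n = trans (sumTo-cong (suc n) (λ k _ → ℤP.*-assoc c (f k) (g (n ∸ k))))
                    (sym (*-distribˡ-sumTo (suc n) c _))

⊛-· : ∀ c f g → f ⊛ (c · g) ≋ c · (f ⊛ g)
⊛-· c f g = ≋-trans (⊛-comm f (c · g)) (≋-trans (·-⊛ c g f) (·-cong c (⊛-comm g f)))

⊛-identityʳ : ∀ f → f ⊛ 𝟙 ≋ f
⊛-identityʳ f n = begin
  sumTo n (λ i → f i * 𝟙 (n ∸ i)) + f n * 𝟙 (n ∸ n) ≡⟨ cong₂ _+_ (sumTo-zero n offDiagonal) (cong (λ k → f n * 𝟙 k) (ℕP.n∸n≡0 n)) ⟩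
  0ℤ + f n * 1ℤ                                     ≡⟨ trans (ℤP.+-identityˡ _) (ℤP.*-identityʳ (f n)) ⟩
  f n                                               ∎
  where
  open ≡-Reasoning
  offDiagonal : ∀ i → i ℕ.< n → f i * 𝟙 (n ∸ i) ≡ 0ℤ
  offDiagonal i i<n with n ∸ i | ℕP.m>n⇒m∸n≢0 i<n
  ... | zero  | n∸i≢0 = ⊥-elim (n∸i≢0 refl)
  ... | suc _ | _     = ℤP.*-zeroʳ (f i)

⊛-identityˡ : ∀ f → 𝟙 ⊛ f ≋ f
⊛-identityˡ f = ≋-trans (⊛-comm 𝟙 f) (⊛-identityʳ f)

⊛-zeroˡ : ∀ f → 𝟘 ⊛ f ≋ 𝟘
⊛-zeroˡ f n = sumTo-zero (suc n) (λ i _ → ℤP.*-zeroˡ (f (n ∸ i)))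

⊛-zeroʳ : ∀ f {g} → g ≋ 𝟘 → f ⊛ g ≋ 𝟘
⊛-zeroʳ f {g} g≋0 = ≋-trans (⊛-comm f g) (≋-trans (⊛-cong g≋0 (≋-refl {f})) (⊛-zeroˡ f))

⊛-commutativeMonoid : CommutativeMonoid _ _
⊛-commutativeMonoid = record
  { Carrier = Series ; _≈_ = _≋_ ; _∙_ = _⊛_ ; ε = 𝟙
  ; isCommutativeMonoid = record
    { isMonoid = record
      { isSemigroup = record
        { isMagma = record { isEquivalence = Setoid.isEquivalence ≋-setoid ; ∙-cong = ⊛-cong }
        ; assoc = ⊛-assoc }
      ; identity = ⊛-identityˡ , ⊛-identityʳ }
    ; comm = ⊛-comm } }

qpow-refl : ∀ a → qpow a a ≡ 1ℤ
qpow-refl a with a ℕ.≟ a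
... | yes _   = refl
... | no a≢a = ⊥-elim (a≢a refl)

qpow-≢ : ∀ {a k} → a ≢ k → qpow a k ≡ 0ℤ
qpow-≢ {a} {k} a≢k with a ℕ.≟ k
... | yes a≡k = ⊥-elim (a≢k a≡k)
... | no _    = refl

qpow-≢-* : ∀ a i x → a ≢ i → qpow a i * x ≡ 0ℤ
qpow-≢-* a i x a≢i = trans (cong (_* x) (qpow-≢ a≢i)) (ℤP.*-zeroˡ x)

qpow-zero : qpow 0 ≋ 𝟙
qpow-zero zero    = refl
qpow-zero (suc n) = refl

shift : ℕ → Series → Series
shift a f n with a ℕ.≤? n
... | yes _ = f (n ∸ a)
... | no _  = 0ℤ

qpow-⊛ : ∀ a f → qpow a ⊛ f ≋ shift a f
qpow-⊛ a f n with a ℕ.≤? n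
... | yes a≤n = trans (sumTo-single (suc n) a _ (s≤s a≤n) (λ i _ i≢a → qpow-≢-* a i (f (n ∸ i)) (≢-sym i≢a)))
                      (trans (cong (_* f (n ∸ a)) (qpow-refl a)) (ℤP.*-identityˡ _))
... | no a≰n  = sumTo-zero (suc n) (λ i i≤n → qpow-≢-* a i (f (n ∸ i)) (λ { refl → a≰n (ℕP.≤-pred i≤n) }))

qpow-+ : ∀ a b → qpow a ⊛ qpow b ≋ qpow (a ℕ.+ b)
qpow-+ a b n = trans (qpow-⊛ a (qpow b) n) (shifted n)
  where
  shifted : ∀ n → shift a (qpow b) n ≡ qpow (a ℕ.+ b) n
  shifted n with a ℕ.≤? n
  ... | no a≰n = sym (qpow-≢ (λ { refl → a≰n (ℕP.m≤m+n a b) }))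
  ... | yes a≤n with b ℕ.≟ n ∸ a
  ...   | yes refl = sym (trans (cong (qpow (a ℕ.+ (n ∸ a))) (sym (ℕP.m+[n∸m]≡n a≤n))) (qpow-refl _))
  ...   | no b≢n∸a = sym (qpow-≢ (λ { refl → b≢n∸a (sym (ℕP.m+n∸m≡n a b)) }))

-- The lookup that `inv` performs in its table of earlier coefficients is local to Defs,
-- so we let unification name it.
private
  invTable : Σ (Series → ℕ → ℕ → ℤ) λ table →
    ∀ f n → inv f (suc n) ≡ - sumTo (suc n) (λ i → f (suc i) * table f n i)
  invTable = _ , λ f n → refl

  invTable-lookup : ∀ f n i → i ℕ.≤ n → proj₁ invTable f n i ≡ inv f (n ∸ i)
  invTable-lookup f zero    zero    _       = refl
  invTable-lookup f (suc n) zero    _       = refl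
  invTable-lookup f (suc n) (suc i) (s≤s i≤n) = invTable-lookup f n i i≤n

inv-suc : ∀ f n → inv f (suc n) ≡ - sumTo (suc n) (λ i → f (suc i) * inv f (n ∸ i))
inv-suc f n = trans (proj₂ invTable f n)
  (cong -_ (sumTo-cong (suc n) (λ i i≤n → cong (f (suc i) *_) (invTable-lookup f n i (ℕP.≤-pred i≤n)))))

⊛-inverseʳ : ∀ f → f 0 ≡ 1ℤ → f ⊛ inv f ≋ 𝟙
⊛-inverseʳ f f0≡1 zero    = cong (λ c → 0ℤ + c * 1ℤ) f0≡1
⊛-inverseʳ f f0≡1 (suc n) = begin
  sumTo (suc (suc n)) (λ k → f k * inv f (suc n ∸ k)) ≡⟨ sumTo-unfoldˡ (suc n) _ ⟩
  f 0 * inv f (suc n) + S                             ≡⟨ cong (λ c → c * inv f (suc n) + S) f0≡1 ⟩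
  1ℤ * inv f (suc n) + S                              ≡⟨ cong (_+ S) (ℤP.*-identityˡ (inv f (suc n))) ⟩
  inv f (suc n) + S                                   ≡⟨ cong (_+ S) (inv-suc f n) ⟩
  - S + S                                             ≡⟨ ℤP.+-inverseˡ S ⟩
  0ℤ                                                  ∎
  where
  open ≡-Reasoning
  S : ℤ
  S = sumTo (suc n) (λ i → f (suc i) * inv f (n ∸ i))

⊛-inv-cancelʳ : ∀ f g → g 0 ≡ 1ℤ → (f ⊛ g) ⊛ inv g ≋ f
⊛-inv-cancelʳ f g g0≡1 = ≋-trans (⊛-assoc f g (inv g))
  (≋-trans (⊛-cong (≋-refl {f}) (⊛-inverseʳ g g0≡1)) (⊛-identityʳ f))

-- Gaussian polynomials and q-binomial coefficients

1-q^ : ℕ → Series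
1-q^ a = 𝟙 ⊕ (- 1ℤ) · qpow a

1-q^-+ : ∀ a b → 1-q^ (a ℕ.+ b) ≋ 1-q^ a ⊕ qpow a ⊛ 1-q^ b
1-q^-+ a b = ≋-trans telescope (⊕-cong (≋-refl {1-q^ a}) (≋-sym qᵃ⊛1-qᵇ))
  where
  qᵃ⊛1-qᵇ : qpow a ⊛ 1-q^ b ≋ qpow a ⊕ (- 1ℤ) · qpow (a ℕ.+ b)
  qᵃ⊛1-qᵇ = ≋-trans (⊛-distribˡ-⊕ (qpow a) 𝟙 ((- 1ℤ) · qpow b))
    (⊕-cong (⊛-identityʳ (qpow a)) (≋-trans (⊛-· (- 1ℤ) (qpow a) (qpow b)) (·-cong (- 1ℤ) (qpow-+ a b))))
  telescope : 1-q^ (a ℕ.+ b) ≋ 1-q^ a ⊕ (qpow a ⊕ (- 1ℤ) · qpow (a ℕ.+ b))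
  telescope n = ring (𝟙 n) (qpow a n) (qpow (a ℕ.+ b) n)
    where
    ring : ∀ o x y → o + - 1ℤ * y ≡ o + - 1ℤ * x + (x + - 1ℤ * y)
    ring = solve-∀

qPoch-constant : ∀ n → qPoch n 0 ≡ 1ℤ
qPoch-constant zero    = refl
qPoch-constant (suc n) rewrite qPoch-constant n = refl

-- gauss k b = [k+b, k]
gauss : ℕ → ℕ → Series
gauss zero    b       = 𝟙
gauss (suc k) zero    = 𝟙
gauss (suc k) (suc b) = gauss (suc k) b ⊕ qpow (suc b) ⊛ gauss k (suc b)

-- The last factor 1 - q^(k+b+2) = (1 - q^(b+1)) + q^(b+1) (1 - q^(k+1)) splits along Pascal's rule.
qPoch-+ : ∀ k b → qPoch (k ℕ.+ b) ≋ gauss k b ⊛ (qPoch k ⊛ qPoch b)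
qPoch-+ zero    b       = ≋-sym (≋-trans (⊛-identityˡ (𝟙 ⊛ qPoch b)) (⊛-identityˡ (qPoch b)))
qPoch-+ (suc k) zero    = ≋-trans (≡⇒≋ (cong qPoch (ℕP.+-identityʳ (suc k))))
  (≋-sym (≋-trans (⊛-identityˡ (qPoch (suc k) ⊛ 𝟙)) (⊛-identityʳ (qPoch (suc k)))))
qPoch-+ (suc k) (suc b) = begin
  R ⊛ 1-q^ (suc k ℕ.+ suc b)                     ≡⟨ cong (λ m → R ⊛ 1-q^ m) (ℕP.+-comm (suc k) (suc b)) ⟩
  R ⊛ 1-q^ (suc b ℕ.+ suc k)                     ≈⟨ ⊛-cong (≋-refl {R}) (1-q^-+ (suc b) (suc k)) ⟩
  R ⊛ (1-q^ (suc b) ⊕ qpow (suc b) ⊛ 1-q^ (suc k)) ≈⟨ ⊛-distribˡ-⊕ R (1-q^ (suc b)) (qpow (suc b) ⊛ 1-q^ (suc k)) ⟩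
  R ⊛ 1-q^ (suc b) ⊕ R ⊛ (qpow (suc b) ⊛ 1-q^ (suc k))
    ≈⟨ ⊕-cong (⊛-cong R≋right (≋-refl {1-q^ (suc b)})) (⊛-cong R≋left (≋-refl {qpow (suc b) ⊛ 1-q^ (suc k)})) ⟩
  gauss (suc k) b ⊛ (qPoch (suc k) ⊛ qPoch b) ⊛ 1-q^ (suc b)
    ⊕ gauss k (suc b) ⊛ (qPoch k ⊛ qPoch (suc b)) ⊛ (qpow (suc b) ⊛ 1-q^ (suc k))
    ≈⟨ ⊕-cong (rearrange₁ (gauss (suc k) b) (qPoch k) (1-q^ (suc k)) (qPoch b) (1-q^ (suc b)))
              (rearrange₂ (gauss k (suc b)) (qPoch k) (qPoch b) (1-q^ (suc b)) (qpow (suc b)) (1-q^ (suc k))) ⟩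
  gauss (suc k) b ⊛ X ⊕ qpow (suc b) ⊛ gauss k (suc b) ⊛ X ≈⟨ ⊛-distribʳ-⊕ (gauss (suc k) b) (qpow (suc b) ⊛ gauss k (suc b)) X ⟨
  gauss (suc k) (suc b) ⊛ X                       ∎
  where
  open ≋-Reasoning
  open CommutativeMonoidSolver ⊛-commutativeMonoid using (solve; _⊜_) renaming (_⊕_ to _∙_)
  R X : Series
  R = qPoch (k ℕ.+ suc b)
  X = qPoch (suc k) ⊛ qPoch (suc b)
  R≋right : R ≋ gauss (suc k) b ⊛ (qPoch (suc k) ⊛ qPoch b)
  R≋right = ≋-trans (≡⇒≋ (cong qPoch (ℕP.+-suc k b))) (qPoch-+ (suc k) b)
  R≋left : R ≋ gauss k (suc b) ⊛ (qPoch k ⊛ qPoch (suc b))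
  R≋left = qPoch-+ k (suc b)
  rearrange₁ : ∀ g p d p′ d′ → g ⊛ ((p ⊛ d) ⊛ p′) ⊛ d′ ≋ g ⊛ ((p ⊛ d) ⊛ (p′ ⊛ d′))
  rearrange₁ = solve 5 (λ g p d p′ d′ → (g ∙ ((p ∙ d) ∙ p′)) ∙ d′ ⊜ g ∙ ((p ∙ d) ∙ (p′ ∙ d′))) ≋-refl
  rearrange₂ : ∀ g p p′ d′ u d → g ⊛ (p ⊛ (p′ ⊛ d′)) ⊛ (u ⊛ d) ≋ u ⊛ g ⊛ ((p ⊛ d) ⊛ (p′ ⊛ d′))
  rearrange₂ = solve 6 (λ g p p′ d′ u d → (g ∙ (p ∙ (p′ ∙ d′))) ∙ (u ∙ d) ⊜ (u ∙ g) ∙ ((p ∙ d) ∙ (p′ ∙ d′))) ≋-refl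

qPoch-⊛-constant : ∀ k b → (qPoch k ⊛ qPoch b) 0 ≡ 1ℤ
qPoch-⊛-constant k b rewrite qPoch-constant k | qPoch-constant b = refl

qbinomℕ≋gauss : ∀ k b → qbinomℕ k b ≋ gauss k b
qbinomℕ≋gauss k b = ≋-trans (⊛-cong (qPoch-+ k b) (≋-refl {inv (qPoch k ⊛ qPoch b)}))
  (⊛-inv-cancelʳ (gauss k b) (qPoch k ⊛ qPoch b) (qPoch-⊛-constant k b))

gauss-comm : ∀ k b → gauss k b ≋ gauss b k
gauss-comm k b = begin
  gauss k b                                  ≈⟨ qbinomℕ≋gauss k b ⟨
  qPoch (k ℕ.+ b) ⊛ inv Q                    ≡⟨ cong (λ m → qPoch m ⊛ inv Q) (ℕP.+-comm k b) ⟩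
  qPoch (b ℕ.+ k) ⊛ inv Q                    ≈⟨ ⊛-cong (qPoch-+ b k) (≋-refl {inv Q}) ⟩
  gauss b k ⊛ (qPoch b ⊛ qPoch k) ⊛ inv Q    ≈⟨ ⊛-cong (⊛-cong (≋-refl {gauss b k}) (⊛-comm (qPoch b) (qPoch k))) (≋-refl {inv Q}) ⟩
  gauss b k ⊛ Q ⊛ inv Q                      ≈⟨ ⊛-inv-cancelʳ (gauss b k) Q (qPoch-⊛-constant k b) ⟩
  gauss b k                                  ∎
  where
  open ≋-Reasoning
  Q : Series
  Q = qPoch k ⊛ qPoch b

gauss-zeroʳ : ∀ k → gauss k 0 ≋ 𝟙
gauss-zeroʳ zero    = ≋-refl {𝟙}
gauss-zeroʳ (suc k) = ≋-refl {𝟙}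

qbinom-≤ : ∀ k b → qbinom (+ (k ℕ.+ b)) (+ k) ≋ gauss k b
qbinom-≤ k b with k ℕ.≤? k ℕ.+ b
... | yes _   = ≋-trans (≡⇒≋ (cong (qbinomℕ k) (ℕP.m+n∸m≡n k b))) (qbinomℕ≋gauss k b)
... | no k≰k+b = ⊥-elim (k≰k+b (ℕP.m≤m+n k b))

qbinom-> : ∀ N K → N ℕ.< K → qbinom (+ N) (+ K) ≋ 𝟘
qbinom-> N K N<K with K ℕ.≤? N
... | yes K≤N = ⊥-elim (ℕP.<⇒≱ N<K K≤N)
... | no _    = ≋-refl {𝟘}

qbinom-diag : ∀ N → qbinom (+ N) (+ N) ≋ 𝟙
qbinom-diag N = ≋-trans (≡⇒≋ (cong (λ m → qbinom (+ m) (+ N)) (sym (ℕP.+-identityʳ N))))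
                        (≋-trans (qbinom-≤ N 0) (gauss-zeroʳ N))

qbinom-support : ∀ N K → qbinom (+ N) K ≋ 𝟘 ⊎ ∃₂ λ k b → K ≡ + k × N ≡ k ℕ.+ b
qbinom-support N -[1+ _ ] = inj₁ (≋-refl {𝟘})
qbinom-support N (+ k) with k ℕ.≤? N
... | yes k≤N = inj₂ (k , N ∸ k , refl , sym (ℕP.m+[n∸m]≡n k≤N))
... | no _    = inj₁ (≋-refl {𝟘})

qbinom-comm : ∀ k b → qbinom (+ (k ℕ.+ b)) (+ k) ≋ qbinom (+ (k ℕ.+ b)) (+ b)
qbinom-comm k b = ≋-trans (qbinom-≤ k b) (≋-trans (gauss-comm k b) (≋-sym
  (≋-trans (≡⇒≋ (cong (λ m → qbinom (+ m) (+ b)) (ℕP.+-comm k b))) (qbinom-≤ b k))))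

qbinom-sym : ∀ N K K′ → K + K′ ≡ + N → qbinom (+ N) K ≋ qbinom (+ N) K′
qbinom-sym N K K′ K+K′≡N with qbinom-support N K | qbinom-support N K′
... | inj₂ (k , b , refl , refl) | _ rewrite +-cancelˡ (+ k) K′ (+ b) K+K′≡N = qbinom-comm k b
... | inj₁ _ | inj₂ (k , b , refl , refl)
  rewrite +-cancelʳ (+ k) K (+ b) (trans K+K′≡N (ℤP.+-comm (+ k) (+ b))) = ≋-sym (qbinom-comm k b)
... | inj₁ K≋0 | inj₁ K′≋0 = ≋-trans K≋0 (≋-sym K′≋0)

⊕-⊛-zeroʳ : ∀ f h {g} → g ≋ 𝟘 → f ⊕ h ⊛ g ≋ f
⊕-⊛-zeroʳ f h g≋0 n = trans (cong (λ x → f n + x) (⊛-zeroʳ h g≋0 n)) (ℤP.+-identityʳ (f n))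

qbinom-pascal-interior : ∀ k b →
  qbinom (+ suc (suc k ℕ.+ b)) (+ suc k)
    ≋ qbinom (+ (suc k ℕ.+ b)) (+ suc k) ⊕ qpowℤ (+ (suc k ℕ.+ b) - + k) ⊛ qbinom (+ (suc k ℕ.+ b)) (+ k)
qbinom-pascal-interior k b = begin
  qbinom (+ suc (suc k ℕ.+ b)) (+ suc k)   ≡⟨ cong (λ m → qbinom (+ m) (+ suc k)) (sym (ℕP.+-suc (suc k) b)) ⟩
  qbinom (+ (suc k ℕ.+ suc b)) (+ suc k)   ≈⟨ qbinom-≤ (suc k) (suc b) ⟩
  gauss (suc k) b ⊕ qpow (suc b) ⊛ gauss k (suc b)
    ≈⟨ ⊕-cong (qbinom-≤ (suc k) b) (⊛-cong (≋-refl {qpow (suc b)}) lower) ⟨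
  qbinom (+ (suc k ℕ.+ b)) (+ suc k) ⊕ qpow (suc b) ⊛ qbinom (+ (suc k ℕ.+ b)) (+ k)
    ≡⟨ cong (λ e → qbinom (+ (suc k ℕ.+ b)) (+ suc k) ⊕ qpowℤ e ⊛ qbinom (+ (suc k ℕ.+ b)) (+ k)) (sym (ring (+ k) (+ b))) ⟩
  qbinom (+ (suc k ℕ.+ b)) (+ suc k) ⊕ qpowℤ (+ (suc k ℕ.+ b) - + k) ⊛ qbinom (+ (suc k ℕ.+ b)) (+ k) ∎
  where
  open ≋-Reasoning
  lower : qbinom (+ (suc k ℕ.+ b)) (+ k) ≋ gauss k (suc b)
  lower = ≋-trans (≡⇒≋ (cong (λ m → qbinom (+ m) (+ k)) (sym (ℕP.+-suc k b)))) (qbinom-≤ k (suc b))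
  ring : ∀ x y → 1ℤ + (x + y) - x ≡ 1ℤ + y
  ring = solve-∀

qbinom-pascal : ∀ N K →
  qbinom (+ suc N) K ≋ qbinom (+ N) K ⊕ qpowℤ (+ N - (K - 1ℤ)) ⊛ qbinom (+ N) (K - 1ℤ)
qbinom-pascal N -[1+ k ] = ≋-sym (⊕-⊛-zeroʳ 𝟘 (qpowℤ (+ N - (-[1+ k ] - 1ℤ))) (≋-refl {𝟘}))
qbinom-pascal N (+ zero) = ≋-trans (qbinom-≤ 0 (suc N))
  (≋-sym (≋-trans (⊕-⊛-zeroʳ (qbinom (+ N) (+ 0)) (qpowℤ (+ N - - 1ℤ)) (≋-refl {𝟘})) (qbinom-≤ 0 N)))
qbinom-pascal N (+ suc k) with ℕ.<-cmp k N
... | tri< k<N _ _ = interior (ℕP.m≤n⇒∃[o]m+o≡n k<N)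
  where
  interior : (∃ λ b → suc k ℕ.+ b ≡ N) →
    qbinom (+ suc N) (+ suc k) ≋ qbinom (+ N) (+ suc k) ⊕ qpowℤ (+ N - + k) ⊛ qbinom (+ N) (+ k)
  interior (b , refl) = qbinom-pascal-interior k b
... | tri≈ _ refl _ = ≋-trans (qbinom-diag (suc k)) (≋-sym (begin
  qbinom (+ k) (+ suc k) ⊕ qpowℤ (+ k - + k) ⊛ qbinom (+ k) (+ k)
    ≈⟨ ⊕-cong (qbinom-> k (suc k) (ℕP.n<1+n k)) (⊛-cong qᵏ⁻ᵏ≋𝟙 (qbinom-diag k)) ⟩
  𝟘 ⊕ 𝟙 ⊛ 𝟙 ≈⟨ (λ n → trans (ℤP.+-identityˡ _) (⊛-identityˡ 𝟙 n)) ⟩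
  𝟙 ∎))
  where
  open ≋-Reasoning
  qᵏ⁻ᵏ≋𝟙 : qpowℤ (+ k - + k) ≋ 𝟙
  qᵏ⁻ᵏ≋𝟙 = ≋-trans (≡⇒≋ (cong qpowℤ (ℤP.+-inverseʳ (+ k)))) qpow-zero
... | tri> _ _ N<k = ≋-trans (qbinom-> (suc N) (suc k) (s≤s N<k)) (≋-sym
  (≋-trans (⊕-⊛-zeroʳ (qbinom (+ N) (+ suc k)) (qpowℤ (+ N - + k)) (qbinom-> N k N<k))
           (qbinom-> N (suc k) (ℕP.m<n⇒m<1+n N<k))))

+[m+n]-+m≡+n : ∀ m n → + (m ℕ.+ n) - + m ≡ + n
+[m+n]-+m≡+n m n = ring (+ m) (+ n)
  where
  ring : ∀ x y → x + y - x ≡ y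
  ring = solve-∀

-- qpowℤ reads a negative exponent as its absolute value, so exponents may only be added
-- where the q-binomial coefficient is nonzero, which forces 0 ≤ N - K.
qpowℤ-⊛-qbinom : ∀ {e} N K → 0ℤ ℤ.≤ e →
  qpowℤ e ⊛ (qpowℤ (+ N - K) ⊛ qbinom (+ N) K) ≋ qpowℤ (e + (+ N - K)) ⊛ qbinom (+ N) K
qpowℤ-⊛-qbinom {+ m} N K (ℤ.+≤+ _) with qbinom-support N K
... | inj₁ K≋0 = ≋-trans (⊛-zeroʳ (qpow m) (⊛-zeroʳ (qpowℤ (+ N - K)) K≋0)) (≋-sym (⊛-zeroʳ (qpowℤ (+ m + (+ N - K))) K≋0))
... | inj₂ (k , b , refl , refl) rewrite +[m+n]-+m≡+n k b =
  ≋-trans (≋-sym (⊛-assoc (qpow m) (qpow b) (qbinom (+ (k ℕ.+ b)) (+ k))))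
          (⊛-cong (qpow-+ m b) (≋-refl {qbinom (+ (k ℕ.+ b)) (+ k)}))

-- Symmetric sums

symSum-cong : ∀ M {F G : ℤ → Series} → (∀ j → F j ≋ G j) → symSum M F ≋ symSum M G
symSum-cong zero    F≋G = F≋G 0ℤ
symSum-cong (suc M) F≋G = ⊕-cong (⊕-cong (symSum-cong M F≋G) (F≋G _)) (F≋G _)

symSum-distrib-⊕ : ∀ M (F G : ℤ → Series) → symSum M (λ j → F j ⊕ G j) ≋ symSum M F ⊕ symSum M G
symSum-distrib-⊕ zero    F G = ≋-refl {F 0ℤ ⊕ G 0ℤ}
symSum-distrib-⊕ (suc M) F G n =
  trans (cong (λ x → x + (F a n + G a n) + (F (- a) n + G (- a) n)) (symSum-distrib-⊕ M F G n))
        (ring (symSum M F n) (symSum M G n) (F a n) (G a n) (F (- a) n) (G (- a) n))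
  where
  a : ℤ
  a = + suc M
  ring : ∀ s t x y u v → s + t + (x + y) + (u + v) ≡ s + x + u + (t + y + v)
  ring = solve-∀

symSum-vanishing-ends : ∀ M F → F (+ suc M) ≋ 𝟘 → F (- + suc M) ≋ 𝟘 → symSum (suc M) F ≋ symSum M F
symSum-vanishing-ends M F F₊≋0 F₋≋0 n =
  trans (cong₂ (λ x y → symSum M F n + x + y) (F₊≋0 n) (F₋≋0 n))
        (trans (ℤP.+-identityʳ _) (ℤP.+-identityʳ _))

-- Under j ↦ -j-2 the window [-M-1, M+1] maps onto [-M-3, M-1]; all terms pair off
-- except j = M and j = M+1.
symSum-odd : ∀ M F → (∀ j n → F (- j - + 2) n ≡ - F j n) → symSum (suc M) F ≋ F (+ M) ⊕ F (+ suc M)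
symSum-odd zero    F odd n = trans (cong (λ x → F 0ℤ n + F (+ 1) n + x) (fixedPoint (odd (- 1ℤ) n))) (ℤP.+-identityʳ _)
  where
  fixedPoint : ∀ {x} → x ≡ - x → x ≡ 0ℤ
  fixedPoint {+ zero}  _  = refl
  fixedPoint {+ suc _} ()
  fixedPoint { -[1+ _ ]} ()
symSum-odd (suc M) F odd n = begin
  symSum (suc M) F n + F (+ 2 + + M) n + F (- (+ 2 + + M)) n
    ≡⟨ cong₂ (λ x y → x + F (+ 2 + + M) n + y) (symSum-odd M F odd n) (trans (cong (λ j → F j n) (ring₁ (+ M))) (odd (+ M) n)) ⟩
  F (+ M) n + F (+ suc M) n + F (+ 2 + + M) n + - F (+ M) n
    ≡⟨ ring₂ (F (+ M) n) (F (+ suc M) n) (F (+ 2 + + M) n) ⟩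
  F (+ suc M) n + F (+ 2 + + M) n ∎
  where
  open ≡-Reasoning
  ring₁ : ∀ x → - (+ 2 + x) ≡ - x - + 2
  ring₁ = solve-∀
  ring₂ : ∀ x y z → x + y + z + - x ≡ y + z
  ring₂ = solve-∀

jacobi3-neg : ∀ a → jacobi3 (- a) ≡ - jacobi3 a
jacobi3-neg (+ zero) = refl
jacobi3-neg (+ suc n) with suc n ℕ.% 3 | m%n<n (suc n) 3
... | 0 | _ = refl
... | 1 | _ = refl
... | 2 | _ = refl
... | suc (suc (suc _)) | s≤s (s≤s (s≤s ()))
jacobi3-neg -[1+ n ] with suc n ℕ.% 3 | m%n<n (suc n) 3
... | 0 | _ = refl
... | 1 | _ = refl
... | 2 | _ = refl
... | suc (suc (suc _)) | s≤s (s≤s (s≤s ()))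

0≤i*[i+1] : ∀ i → 0ℤ ℤ.≤ i * (i + 1ℤ)
0≤i*[i+1] (+ n)    = subst (0ℤ ℤ.≤_) (ℤP.pos-* n (n ℕ.+ 1)) (ℤ.+≤+ ℕ.z≤n)
0≤i*[i+1] -[1+ n ] = subst (0ℤ ℤ.≤_) (ring (+ n)) (0≤i*[i+1] (+ n))
  where
  ring : ∀ x → x * (x + 1ℤ) ≡ - (1ℤ + x) * (- (1ℤ + x) + 1ℤ)
  ring = solve-∀

module _ (L : ℕ) where

  2L : ℕ
  2L = L ℕ.+ L

  summand : ℤ → ℤ → Series
  summand N j = jacobi3 (j + 1ℤ) · (qpowℤ (j * (j + 1ℤ)) ⊛ qbinom N (+ L - j))

  correction : ℤ → Series
  correction j = jacobi3 (j + 1ℤ) · (qpowℤ ((j + 1ℤ) * (j + 1ℤ) + + L) ⊛ qbinom (+ 2L) (+ L - j - 1ℤ))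

  summand-vanishes : ∀ N j → qbinom N (+ L - j) ≋ 𝟘 → summand N j ≋ 𝟘
  summand-vanishes N j B≋0 = ·-zero (jacobi3 (j + 1ℤ)) (⊛-zeroʳ (qpowℤ (j * (j + 1ℤ))) B≋0)

  summand-top-vanishes : summand (+ 2L) (+ suc L) ≋ 𝟘
  summand-top-vanishes = summand-vanishes (+ 2L) (+ suc L) (≡⇒≋ (cong (qbinom (+ 2L)) (ring (+ L))))
    where
    ring : ∀ x → x - (1ℤ + x) ≡ - 1ℤ
    ring = solve-∀

  summand-bottom-vanishes : summand (+ 2L) (- + suc L) ≋ 𝟘
  summand-bottom-vanishes =
    summand-vanishes (+ 2L) (- + suc L) (qbinom-> 2L (L ℕ.+ suc L) (ℕP.+-monoʳ-< L (ℕP.n<1+n L)))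

  summand-pascal : ∀ j → summand (+ suc 2L) j ≋ summand (+ 2L) j ⊕ correction j
  summand-pascal j = begin
    χ · (E ⊛ qbinom (+ suc 2L) K)                            ≈⟨ ·-cong χ (⊛-cong (≋-refl {E}) (qbinom-pascal 2L K)) ⟩
    χ · (E ⊛ (qbinom (+ 2L) K ⊕ qpowℤ e ⊛ B))               ≈⟨ ·-cong χ (⊛-distribˡ-⊕ E (qbinom (+ 2L) K) (qpowℤ e ⊛ B)) ⟩
    χ · (E ⊛ qbinom (+ 2L) K ⊕ E ⊛ (qpowℤ e ⊛ B))           ≈⟨ ·-distrib-⊕ χ (E ⊛ qbinom (+ 2L) K) (E ⊛ (qpowℤ e ⊛ B)) ⟩
    summand (+ 2L) j ⊕ χ · (E ⊛ (qpowℤ e ⊛ B))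
      ≈⟨ ⊕-cong (≋-refl {summand (+ 2L) j}) (·-cong χ (qpowℤ-⊛-qbinom 2L (K - 1ℤ) (0≤i*[i+1] j))) ⟩
    summand (+ 2L) j ⊕ χ · (qpowℤ (j * (j + 1ℤ) + e) ⊛ B)  ≡⟨ cong (λ d → summand (+ 2L) j ⊕ χ · (qpowℤ d ⊛ B)) (ring (+ L) j) ⟩
    summand (+ 2L) j ⊕ correction j                          ∎
    where
    open ≋-Reasoning
    K e χ : ℤ
    K = + L - j
    e = + 2L - (K - 1ℤ)
    χ = jacobi3 (j + 1ℤ)
    E B : Series
    E = qpowℤ (j * (j + 1ℤ))
    B = qbinom (+ 2L) (K - 1ℤ)
    ring : ∀ x j → j * (j + 1ℤ) + (x + x - (x - j - 1ℤ)) ≡ (j + 1ℤ) * (j + 1ℤ) + x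
    ring = solve-∀

  correction-odd : ∀ j n → correction (- j - + 2) n ≡ - correction j n
  correction-odd j n = begin
    jacobi3 (j′ + 1ℤ) * (qpowℤ ((j′ + 1ℤ) * (j′ + 1ℤ) + + L) ⊛ qbinom (+ 2L) (+ L - j′ - 1ℤ)) n
      ≡⟨ cong₂ _*_ χ-odd (⊛-cong (≡⇒≋ (cong qpowℤ (exponent-even (+ L) j))) binomial-even n) ⟩
    - jacobi3 (j + 1ℤ) * (qpowℤ ((j + 1ℤ) * (j + 1ℤ) + + L) ⊛ qbinom (+ 2L) (+ L - j - 1ℤ)) n
      ≡⟨ ℤP.neg-distribˡ-* (jacobi3 (j + 1ℤ)) _ ⟨
    - correction j n ∎
    where
    open ≡-Reasoning
    j′ : ℤ
    j′ = - j - + 2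
    χ-odd : jacobi3 (j′ + 1ℤ) ≡ - jacobi3 (j + 1ℤ)
    χ-odd = trans (cong jacobi3 (ring j)) (jacobi3-neg (j + 1ℤ))
      where
      ring : ∀ j → - j - + 2 + 1ℤ ≡ - (j + 1ℤ)
      ring = solve-∀
    exponent-even : ∀ x j → (- j - + 2 + 1ℤ) * (- j - + 2 + 1ℤ) + x ≡ (j + 1ℤ) * (j + 1ℤ) + x
    exponent-even = solve-∀
    binomial-even : qbinom (+ 2L) (+ L - j′ - 1ℤ) ≋ qbinom (+ 2L) (+ L - j - 1ℤ)
    binomial-even = qbinom-sym 2L (+ L - j′ - 1ℤ) (+ L - j - 1ℤ) (ring (+ L) j)
      where
      ring : ∀ x j → x - (- j - + 2) - 1ℤ + (x - j - 1ℤ) ≡ x + x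
      ring = solve-∀

  corrections-cancel : symSum (suc L) correction ≋ 𝟘
  corrections-cancel = ≋-trans (symSum-odd L correction correction-odd)
    (λ n → cong₂ _+_ (lowerIndexNegative (+ L) (ring₁ (+ L)) n) (lowerIndexNegative (+ suc L) (ring₂ (+ L)) n))
    where
    lowerIndexNegative : ∀ j {k} → + L - j - 1ℤ ≡ -[1+ k ] → correction j ≋ 𝟘
    lowerIndexNegative j eq = ·-zero (jacobi3 (j + 1ℤ))
      (⊛-zeroʳ (qpowℤ ((j + 1ℤ) * (j + 1ℤ) + + L)) (≡⇒≋ (cong (qbinom (+ 2L)) eq)))
    ring₁ : ∀ x → x - x - 1ℤ ≡ - 1ℤ
    ring₁ = solve-∀
    ring₂ : ∀ x → x - (1ℤ + x) - 1ℤ ≡ - + 2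
    ring₂ = solve-∀

theorem11 : (L : ℕ) →
    symSum L (λ j → jacobi3 (j + 1ℤ) · (qpowℤ (j * (j + 1ℤ)) ⊛ qbinom (+ 2 * + L) (+ L - j)))
    ≋ symSum (suc L) (λ j → jacobi3 (j + 1ℤ) · (qpowℤ (j * (j + 1ℤ)) ⊛ qbinom (+ 2 * + L + 1ℤ) (+ L - j)))
theorem11 L = begin
  symSum L (summand L (+ 2 * + L))                    ≡⟨ cong (λ N → symSum L (summand L N)) (double (+ L)) ⟩
  symSum L S₂ₗ                                        ≈⟨ symSum-vanishing-ends L S₂ₗ (summand-top-vanishes L) (summand-bottom-vanishes L) ⟨
  symSum (suc L) S₂ₗ                                  ≈⟨ ⊕-identityʳ (symSum (suc L) S₂ₗ) ⟨
  symSum (suc L) S₂ₗ ⊕ 𝟘                              ≈⟨ ⊕-cong (≋-refl {symSum (suc L) S₂ₗ}) (corrections-cancel L) ⟨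
  symSum (suc L) S₂ₗ ⊕ symSum (suc L) (correction L)  ≈⟨ symSum-distrib-⊕ (suc L) S₂ₗ (correction L) ⟨
  symSum (suc L) (λ j → S₂ₗ j ⊕ correction L j)       ≈⟨ symSum-cong (suc L) (summand-pascal L) ⟨
  symSum (suc L) (summand L (+ suc (2L L)))           ≡⟨ cong (λ N → symSum (suc L) (summand L N)) (double+1 (+ L)) ⟨
  symSum (suc L) (summand L (+ 2 * + L + 1ℤ))         ∎
  where
  open ≋-Reasoning
  S₂ₗ : ℤ → Series
  S₂ₗ = summand L (+ 2L L)
  double : ∀ x → + 2 * x ≡ x + x
  double = solve-∀
  double+1 : ∀ x → + 2 * x + 1ℤ ≡ 1ℤ + (x + x)
  double+1 = solve-∀
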